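{- A graph $G$ is an iso-unique Grundy domination graph if and only if every connected component of $G$ is a complete graph.
   Context: For a vertex $v$, $N[v]$ is its closed neighborhood. A closed neighborhood sequence of $G$ is a sequence $(v_1,\ldots,v_k)$ of distinct vertices such that for each $i\in[k]$, $N[v_i]\setminus\bigcup_{j=1}^{i-1}N[v_j]\neq\emptyset$. A Grundy dominating set is the set of vertices of a closed neighborhood sequence of maximum length. $G$ is an iso-unique Grundy domination graph if for every two Grundy dominating sets $A,B$ of $G$ there is an automorphism $\phi$ of $G$ with $\phi(A)=B$. -}

module Defs where

open import Data.Nat using (ℕ; _≤_)
open import Data.Bool using (Bool; true; false)
open import Data.Fin using (Fin)
open import Data.Fin.Subset using (Subset; _∈_)
open import Data.Fin.Permutation using (Permutation′; _⟨$⟩ʳ_)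
open import Data.List using (List; []; _∷_; length)
open import Data.List.Relation.Unary.All using (All)
open import Data.List.Relation.Unary.Unique.Propositional using (Unique)
import Data.List.Membership.Propositional as LM
open import Data.Product using (Σ; ∃; _×_)
open import Data.Sum using (_⊎_)
open import Data.Unit using (⊤)
open import Relation.Nullary using (¬_)
open import Relation.Binary.PropositionalEquality using (_≡_)
open import Relation.Binary.Construct.Closure.ReflexiveTransitive using (Star)
open import Function.Bundles using (_⇔_)

record Graph (n : ℕ) : Set where
  field
    adj    : Fin n → Fin n → Bool
    sym    : ∀ u v → adj u v ≡ adj v u
    irrefl : ∀ v → adj v v ≡ false

module _ {n : ℕ} (G : Graph n) where
  open Graph G

  Adj : Fin n → Fin n → Set
  Adj u v = adj u v ≡ true

  InN : Fin n → Fin n → Set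
  InN v u = u ≡ v ⊎ Adj v u

  Footprints : List (Fin n) → Fin n → Set
  Footprints prev v = ∃ λ u → InN v u × All (λ w → ¬ InN w u) prev

  -- the condition on a sequence, given the (reversed) prefix already chosen
  CNSFrom : List (Fin n) → List (Fin n) → Set
  CNSFrom prev []       = ⊤
  CNSFrom prev (v ∷ vs) = Footprints prev v × CNSFrom (v ∷ prev) vs

  IsCNS : List (Fin n) → Set
  IsCNS s = Unique s × CNSFrom [] s

  IsGrundySeq : List (Fin n) → Set
  IsGrundySeq s = IsCNS s × (∀ t → IsCNS t → length t ≤ length s)

  IsGrundyDominatingSet : Subset n → Set
  IsGrundyDominatingSet A =
    Σ (List (Fin n)) λ s → IsGrundySeq s × (∀ v → (v ∈ A) ⇔ (v LM.∈ s))

  IsAutomorphism : Permutation′ n → Set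
  IsAutomorphism φ = ∀ u v → adj (φ ⟨$⟩ʳ u) (φ ⟨$⟩ʳ v) ≡ adj u v

  IsoUniqueGrundyDomination : Set
  IsoUniqueGrundyDomination =
    ∀ A B → IsGrundyDominatingSet A → IsGrundyDominatingSet B →
      Σ (Permutation′ n) λ φ → IsAutomorphism φ ×
        (∀ v → (v ∈ A) ⇔ ((φ ⟨$⟩ʳ v) ∈ B))

  SameComponent : Fin n → Fin n → Set
  SameComponent = Star Adj

  ComponentsComplete : Set
  ComponentsComplete = ∀ u v → SameComponent u v → ¬ (u ≡ v) → Adj u v

-- If every component is a clique, closed neighbourhoods partition the vertex set into
-- cliques, and a closed neighbourhood sequence can pick at most one vertex of each clique;
-- a maximum one therefore picks exactly one, and swapping the two chosen vertices in each
-- clique is an automorphism between any two Grundy dominating sets.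
--
-- Conversely, suppose u and v lie in a common component but are not adjacent. The closed
-- neighbourhood of a vertex of that component misses those of all other components, so
-- moving the last such vertex of a Grundy sequence to the end keeps it Grundy, and its
-- prefix P then leaves a vertex of the component undominated. If a vertex a undominated by
-- P had a neighbour b dominated by P, then P a and P b would both be Grundy sequences, but
-- P b induces strictly more non-isolated vertices than P a (all those of P a, and b), so
-- no automorphism maps one vertex set to the other. Hence the whole component, u and v
-- included, is undominated by P, and then the Grundy sequence P u fails to dominate v.
module Submission where

open import Defs
open import Level using (0ℓ)
open import Data.Nat using (ℕ; zero; suc; _≤_; _<_; _+_; _∸_; z≤n; s≤s)
open import Data.Nat.Properties
  using (+-0-commutativeMonoid; ≤-refl; ≤-trans; ≤-antisym; <-irrefl; ≤-reflexive;
         ≰⇒>; ≮⇒≥; +-mono-≤; +-mono-<-≤; +-mono-≤-<; +-monoˡ-≤; +-suc; +-identityʳ;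
         +-comm; m≤n+m∸n; _≤?_; <⇒≢)
open import Data.Bool using (Bool; true; false)
import Data.Bool.Properties as Bool
open import Data.Fin using (Fin; zero; suc)
open import Data.Fin.Properties using (_≟_; pigeonhole)
import Data.Fin.Properties as Fin
open import Data.Fin.Subset using (Subset) renaming (_∈_ to _∈ₛ_)
open import Data.Fin.Permutation using (Permutation′; permutation; _⟨$⟩ʳ_; _⟨$⟩ˡ_; inverseˡ; inverseʳ)
open import Data.Vec using (tabulate)
open import Data.Vec.Properties using (lookup∘tabulate; []=⇒lookup; lookup⇒[]=)
open import Data.List using (List; []; _∷_; _++_; _∷ʳ_; _ʳ++_; reverse; length; lookup)
open import Data.List.Properties using (length-++; length-++-sucʳ)
open import Data.List.Relation.Unary.All as All using (All; _∷_)
open import Data.List.Relation.Unary.All.Properties using (¬Any⇒All¬; All¬⇒¬Any; ¬All⇒Any¬)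
open import Data.List.Relation.Unary.AllPairs using ([]; _∷_)
open import Data.List.Relation.Unary.Any as Any using (Any; here; there; any?)
import Data.List.Relation.Unary.Any.Properties as Any
open import Data.List.Relation.Unary.Unique.Propositional using (Unique)
open import Data.List.Membership.Propositional using (_∈_; find)
open import Data.List.Membership.Propositional.Properties using (∈-lookup; ∈-++⁻; ∈-++⁺ˡ; ∈-++⁺ʳ)
open import Data.Product using (∃; ∃-syntax; _×_; _,_; proj₁; proj₂)
open import Data.Sum using (_⊎_; inj₁; inj₂; [_,_])
open import Data.Empty using (⊥-elim)
open import Function using (_∘_; const)
open import Function.Bundles using (_⇔_; mk⇔; Equivalence)
import Function.Properties.Equivalence as ⇔
open import Relation.Unary using (Pred; Decidable; _⊆_)
open import Relation.Nullary using (¬_; Dec; yes; no; does; contradiction)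
open import Relation.Nullary.Decidable using (_⊎-dec_; _×-dec_; ¬?; decidable-stable; ¬¬-excluded-middle)
open import Relation.Binary.PropositionalEquality using (_≡_; refl; sym; trans; cong; subst)
open import Relation.Binary.Construct.Closure.ReflexiveTransitive using (ε; _◅_; _◅◅_)
import Relation.Binary.Construct.Closure.ReflexiveTransitive as Star
open import Algebra.Properties.CommutativeMonoid.Sum +-0-commutativeMonoid
  using (sum; sum-permute; sum-cong-≗)

open Equivalence using (to; from)

indicator : {P : Set} → Dec P → ℕ
indicator (yes _) = 1
indicator (no _)  = 0

indicator-mono : {P Q : Set} (P? : Dec P) (Q? : Dec Q) → (P → Q) → indicator P? ≤ indicator Q?
indicator-mono (yes p) (yes _) _   = ≤-refl
indicator-mono (yes p) (no ¬q) p→q = contradiction (p→q p) ¬q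
indicator-mono (no _)  _       _   = z≤n

indicator-< : {P Q : Set} (P? : Dec P) (Q? : Dec Q) → ¬ P → Q → indicator P? < indicator Q?
indicator-< (yes p) _       ¬p _ = contradiction p ¬p
indicator-< (no _)  (yes _) _  _ = s≤s z≤n
indicator-< (no _)  (no ¬q) _  q = contradiction q ¬q

indicator-cong : {P Q : Set} (P? : Dec P) (Q? : Dec Q) → P ⇔ Q → indicator P? ≡ indicator Q?
indicator-cong P? Q? P⇔Q = ≤-antisym (indicator-mono P? Q? (to P⇔Q)) (indicator-mono Q? P? (from P⇔Q))

sum-mono-≤ : ∀ {m} {f g : Fin m → ℕ} → (∀ i → f i ≤ g i) → sum f ≤ sum g
sum-mono-≤ {zero}  _   = z≤n
sum-mono-≤ {suc m} f≤g = +-mono-≤ (f≤g zero) (sum-mono-≤ (f≤g ∘ suc))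

sum-mono-< : ∀ {m} {f g : Fin m → ℕ} → (∀ i → f i ≤ g i) → ∀ j → f j < g j → sum f < sum g
sum-mono-< f≤g zero    fj<gj = +-mono-<-≤ fj<gj (sum-mono-≤ (f≤g ∘ suc))
sum-mono-< f≤g (suc j) fj<gj = +-mono-≤-< (f≤g zero) (sum-mono-< (f≤g ∘ suc) j fj<gj)

count : ∀ {m} {P : Pred (Fin m) 0ℓ} → Decidable P → ℕ
count P? = sum (indicator ∘ P?)

⊂⇒count< : ∀ {m} {P Q : Pred (Fin m) 0ℓ} (P? : Decidable P) (Q? : Decidable Q) →
           P ⊆ Q → ∀ i → ¬ P i → Q i → count P? < count Q?
⊂⇒count< P? Q? P⊆Q i ¬Pi Qi =
  sum-mono-< (λ j → indicator-mono (P? j) (Q? j) P⊆Q) i (indicator-< (P? i) (Q? i) ¬Pi Qi)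

count-permute : ∀ {m} {P Q : Pred (Fin m) 0ℓ} (P? : Decidable P) (Q? : Decidable Q)
                (π : Permutation′ m) → (∀ i → P i ⇔ Q (π ⟨$⟩ʳ i)) → count P? ≡ count Q?
count-permute P? Q? π P⇔Qπ =
  trans (sum-cong-≗ (λ i → indicator-cong (P? i) (Q? (π ⟨$⟩ʳ i)) (P⇔Qπ i)))
        (sym (sum-permute (indicator ∘ Q?) π))

¬¬-decidable : ∀ {m} (P : Pred (Fin m) 0ℓ) → ¬ ¬ Decidable P
¬¬-decidable {zero}  P k = k λ ()
¬¬-decidable {suc m} P k =
  ¬¬-excluded-middle λ P0? → ¬¬-decidable (P ∘ suc) λ P′? → k λ { zero → P0? ; (suc i) → P′? i }

¬¬-maximum : {A : Set} {P : Pred A 0ℓ} (f : A → ℕ) (N : ℕ) → (∀ a → P a → f a ≤ N) →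
             ∀ {a} → P a → ¬ ¬ (∃[ m ] P m × ∀ b → P b → f b ≤ f m)
¬¬-maximum {P = P} f N bounded {a} Pa = search (N ∸ f a) Pa (m≤n+m∸n N (f a))
  where
  search : ∀ slack {a} → P a → N ≤ f a + slack → ¬ ¬ (∃[ m ] P m × ∀ b → P b → f b ≤ f m)
  search zero    Pa N≤fa k = k (_ , Pa , λ b Pb → ≤-trans (bounded b Pb) (subst (N ≤_) (+-identityʳ _) N≤fa))
  search (suc s) {a} Pa N≤ k = ¬¬-excluded-middle {A = ∃[ b ] P b × f a < f b} λ
    { (yes (b , Pb , fa<fb)) → search s Pb (≤-trans N≤ (≤-trans (≤-reflexive (+-suc (f a) s)) (+-monoˡ-≤ s fa<fb))) k
    ; (no ¬larger) → k (a , Pa , λ b Pb → ≮⇒≥ λ fa<fb → ¬larger (b , Pb , fa<fb)) }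

splitAtLast : {A : Set} {P : Pred A 0ℓ} → Decidable P → ∀ {xs} → Any P xs →
              ∃[ ys ] ∃[ x ] ∃[ zs ] xs ≡ ys ++ x ∷ zs × P x × All (¬_ ∘ P) zs
splitAtLast P? {x ∷ xs} pxs with any? P? xs
... | yes pxs′ = let ys , y , zs , eq , py , ¬pzs = splitAtLast P? pxs′ in
                 x ∷ ys , y , zs , cong (x ∷_) eq , py , ¬pzs
splitAtLast P? (here px)    | no ¬pxs = [] , _ , _ , refl , px , ¬Any⇒All¬ _ ¬pxs
splitAtLast P? (there pxs′) | no ¬pxs = contradiction pxs′ ¬pxs

All-reverse⁺ : {A : Set} {P : Pred A 0ℓ} {xs : List A} → All P xs → All P (reverse xs)
All-reverse⁺ Pxs = All.tabulate (All.lookup Pxs ∘ Any.reverse⁻)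

All-reverse⁻ : {A : Set} {P : Pred A 0ℓ} {xs : List A} → All P (reverse xs) → All P xs
All-reverse⁻ Pxs = All.tabulate (All.lookup Pxs ∘ Any.reverse⁺)

∈-∷ʳ⁻ : {A : Set} {x y : A} (xs : List A) → y ∈ xs ∷ʳ x → y ∈ xs ⊎ y ≡ x
∈-∷ʳ⁻ xs y∈ with ∈-++⁻ xs y∈
... | inj₁ y∈xs        = inj₁ y∈xs
... | inj₂ (here y≡x) = inj₂ y≡x

Unique-lookup-injective : ∀ {m} (xs : List (Fin m)) → Unique xs → ∀ i j → lookup xs i ≡ lookup xs j → i ≡ j
Unique-lookup-injective (x ∷ xs) (x∉ ∷ u) zero    zero    _ = refl
Unique-lookup-injective (x ∷ xs) (x∉ ∷ u) zero    (suc j) e = contradiction e (All.lookup x∉ (∈-lookup j))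
Unique-lookup-injective (x ∷ xs) (x∉ ∷ u) (suc i) zero    e = contradiction (sym e) (All.lookup x∉ (∈-lookup i))
Unique-lookup-injective (x ∷ xs) (x∉ ∷ u) (suc i) (suc j) e = cong suc (Unique-lookup-injective xs u i j e)

Unique⇒length≤ : ∀ {m} (xs : List (Fin m)) → Unique xs → length xs ≤ m
Unique⇒length≤ {m} xs u with length xs ≤? m
... | yes ≤m = ≤m
... | no ≰m  = let i , j , i<j , eq = pigeonhole (≰⇒> ≰m) (lookup xs) in
               contradiction (Unique-lookup-injective xs u i j eq) (Fin.<⇒≢ i<j)

≡true-⇔⇒≡ : {a b : Bool} → (a ≡ true ⇔ b ≡ true) → a ≡ b
≡true-⇔⇒≡ {true}  {true}  _ = refl
≡true-⇔⇒≡ {true}  {false} h = sym (to h refl)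
≡true-⇔⇒≡ {false} {true}  h = from h refl
≡true-⇔⇒≡ {false} {false} _ = refl

module _ {n : ℕ} (G : Graph n) where
  open Graph G using (adj; irrefl) renaming (sym to adj-sym)
  open import Data.List.Membership.DecPropositional (_≟_ {n}) using (_∈?_)

  Adj-sym : ∀ {u v} → Adj G u v → Adj G v u
  Adj-sym {u} {v} uv = trans (adj-sym v u) uv

  Adj-irrefl : ∀ {v} → ¬ Adj G v v
  Adj-irrefl {v} vv = contradiction (trans (sym vv) (irrefl v)) λ ()

  InN-sym : ∀ {x y} → InN G x y → InN G y x
  InN-sym (inj₁ refl) = inj₁ refl
  InN-sym (inj₂ xy)   = inj₂ (Adj-sym xy)

  InN? : ∀ x y → Dec (InN G x y)
  InN? x y = (y ≟ x) ⊎-dec (adj x y Bool.≟ true)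

  InN⇒SameComponent : ∀ {x y} → InN G x y → SameComponent G x y
  InN⇒SameComponent (inj₁ refl) = ε
  InN⇒SameComponent (inj₂ xy)   = xy ◅ ε

  Undominated : List (Fin n) → Fin n → Set
  Undominated L y = All (λ w → ¬ InN G w y) L

  Separated : Fin n → Fin n → Set
  Separated x w = ∀ {z} → InN G x z → ¬ InN G w z

  Closed : Pred (Fin n) 0ℓ → Set
  Closed C = ∀ {x y} → C x → Adj G x y → C y

  Closed-InN : ∀ {C} → Closed C → ∀ {x y} → C x → InN G x y → C y
  Closed-InN closed Cx (inj₁ refl) = Cx
  Closed-InN closed Cx (inj₂ xy)   = closed Cx xy

  SameComponent-closed : ∀ {u} → Closed (SameComponent G u)
  SameComponent-closed u~x xy = u~x ◅◅ (xy ◅ ε)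

  Closed⇒Separated : ∀ {C} → Closed C → ∀ {x w} → C x → ¬ C w → Separated x w
  Closed⇒Separated closed Cx ¬Cw xz wz = ¬Cw (Closed-InN closed (Closed-InN closed Cx xz) (InN-sym wz))

  CNSFrom-weaken : ∀ {prev prev′} s → (∀ {z} → Undominated prev z → Undominated prev′ z) →
                   CNSFrom G prev s → CNSFrom G prev′ s
  CNSFrom-weaken []       _      _                        = _
  CNSFrom-weaken (v ∷ vs) weaken ((z , vz , und) , rest) =
    (z , vz , weaken und) , CNSFrom-weaken vs (λ { (w ∷ ws) → w ∷ weaken ws }) rest

  CNSFrom-fresh : ∀ {prev y} s → CNSFrom G prev s → y ∈ prev → ¬ y ∈ s
  CNSFrom-fresh (v ∷ vs) ((z , vz , und) , _) y∈prev (here refl) = All.lookup und y∈prev vz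
  CNSFrom-fresh (v ∷ vs) (_ , rest) y∈prev (there y∈vs) = CNSFrom-fresh vs rest (there y∈prev) y∈vs

  CNSFrom⇒Unique : ∀ {prev} s → CNSFrom G prev s → Unique s
  CNSFrom⇒Unique []       _           = []
  CNSFrom⇒Unique (v ∷ vs) (_ , rest) =
    All.tabulate (λ y∈vs v≡y → CNSFrom-fresh vs rest (here refl) (subst (_∈ vs) (sym v≡y) y∈vs))
    ∷ CNSFrom⇒Unique vs rest

  CNSFrom⇒IsCNS : ∀ {s} → CNSFrom G [] s → IsCNS G s
  CNSFrom⇒IsCNS {s} c = CNSFrom⇒Unique s c , c

  CNSFrom-∷ʳ⁻ : ∀ {prev x} P → CNSFrom G prev (P ∷ʳ x) → CNSFrom G prev P × Footprints G (P ʳ++ prev) x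
  CNSFrom-∷ʳ⁻ []      (fp , _)    = _ , fp
  CNSFrom-∷ʳ⁻ (v ∷ P) (fp , rest) = let c , fpx = CNSFrom-∷ʳ⁻ P rest in (fp , c) , fpx

  CNSFrom-∷ʳ⁺ : ∀ {prev x} P → CNSFrom G prev P → Footprints G (P ʳ++ prev) x → CNSFrom G prev (P ∷ʳ x)
  CNSFrom-∷ʳ⁺ []      _           fpx = fpx , _
  CNSFrom-∷ʳ⁺ (v ∷ P) (fp , rest) fpx = fp , CNSFrom-∷ʳ⁺ P rest fpx

  CNSFrom-postpone : ∀ {prev x} t r → All (Separated x) r →
                     CNSFrom G prev (t ++ x ∷ r) → CNSFrom G prev ((t ++ r) ∷ʳ x)
  CNSFrom-postpone (v ∷ t) r seps (fp , rest) = fp , CNSFrom-postpone t r seps rest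
  CNSFrom-postpone [] []      _            c = c
  CNSFrom-postpone [] (y ∷ r) (sep ∷ seps) ((z , xz , und) , (z′ , yz′ , _ ∷ und′) , rest) =
    (z′ , yz′ , und′) ,
    CNSFrom-postpone [] r seps ((z , xz , sep xz ∷ und) , CNSFrom-weaken r (λ { (p ∷ q ∷ ps) → q ∷ p ∷ ps }) rest)

  IsCNS⇒length≤ : ∀ {s} → IsCNS G s → length s ≤ n
  IsCNS⇒length≤ {s} (u , _) = Unique⇒length≤ s u

  ¬¬-IsGrundySeq : ¬ ¬ ∃ (IsGrundySeq G)
  ¬¬-IsGrundySeq = ¬¬-maximum length n (λ _ → IsCNS⇒length≤) (CNSFrom⇒IsCNS {[]} _)

  IsGrundySeq-≤ : ∀ {s t} → IsGrundySeq G s → CNSFrom G [] t → length s ≤ length t → IsGrundySeq G t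
  IsGrundySeq-≤ (_ , max) c s≤t = CNSFrom⇒IsCNS c , λ t′ c′ → ≤-trans (max t′ c′) s≤t

  IsGrundySeq-dominates : ∀ {s} → IsGrundySeq G s → ∀ y → Any (λ w → InN G w y) s
  IsGrundySeq-dominates {s} ((_ , c) , max) y with any? (λ w → InN? w y) s
  ... | yes dom = dom
  ... | no ¬dom = contradiction (max (s ∷ʳ y) longer) too-long
    where
    longer : IsCNS G (s ∷ʳ y)
    longer = CNSFrom⇒IsCNS (CNSFrom-∷ʳ⁺ s c (y , inj₁ refl , All-reverse⁺ (¬Any⇒All¬ s ¬dom)))
    too-long : ¬ length (s ∷ʳ y) ≤ length s
    too-long ≤s = <-irrefl refl (≤-trans (≤-reflexive (sym (trans (length-++ s) (+-comm _ 1)))) ≤s)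

  IsGrundySeq-∷ʳ-footprint : ∀ {P x} → IsGrundySeq G (P ∷ʳ x) → ∃[ z ] InN G x z × Undominated P z
  IsGrundySeq-∷ʳ-footprint {P} ((_ , c) , _) =
    let _ , z , xz , und = CNSFrom-∷ʳ⁻ P c in z , xz , All-reverse⁻ und

  IsGrundySeq-∷ʳ-replace : ∀ {P x y z} → IsGrundySeq G (P ∷ʳ x) → Undominated P z → InN G y z →
                           IsGrundySeq G (P ∷ʳ y)
  IsGrundySeq-∷ʳ-replace {P} g@((_ , c) , _) und yz =
    IsGrundySeq-≤ g (CNSFrom-∷ʳ⁺ P (proj₁ (CNSFrom-∷ʳ⁻ P c)) (_ , yz , All-reverse⁺ und))
      (≤-reflexive (trans (length-++ P) (sym (length-++ P))))

  IsGrundySeq-postpone : ∀ {t x r} → IsGrundySeq G (t ++ x ∷ r) → All (Separated x) r →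
                         IsGrundySeq G ((t ++ r) ∷ʳ x)
  IsGrundySeq-postpone {t} {x} {r} g@((_ , c) , _) seps =
    IsGrundySeq-≤ g (CNSFrom-postpone t r seps c)
      (≤-reflexive (trans (length-++-sucʳ t x r) (sym (trans (length-++ (t ++ r)) (+-comm _ 1)))))

  -- Undominated vertices u, v of P both footprint as a last vertex, so P u must dominate v.
  undominated-InN : ∀ {P x u v} → IsGrundySeq G (P ∷ʳ x) → Undominated P u → Undominated P v → InN G u v
  undominated-InN {P} g und-u und-v
    with Any.++⁻ P (IsGrundySeq-dominates (IsGrundySeq-∷ʳ-replace g und-u (inj₁ refl)) _)
  ... | inj₁ P-dom-v   = contradiction P-dom-v (All¬⇒¬Any und-v)
  ... | inj₂ (here uv) = uv

  -- Move the last vertex of a closed set C to the end of a Grundy sequence meeting C.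
  undominated-in-closed : ∀ {s C u} → IsGrundySeq G s → Decidable C → Closed C → C u →
                          ∃[ P ] ∃[ x ] ∃[ z ] IsGrundySeq G (P ∷ʳ x) × Undominated P z × C z
  undominated-in-closed g C? closed Cu =
    let w , w∈s , wu = find (IsGrundySeq-dominates g _)
        t , x , r , s≡ , Cx , ¬Cr = splitAtLast C? (Any.map (λ { refl → Closed-InN closed Cu (InN-sym wu) }) w∈s)
        g′ = IsGrundySeq-postpone (subst (IsGrundySeq G) s≡ g) (All.map (Closed⇒Separated closed Cx) ¬Cr)
        z , xz , und = IsGrundySeq-∷ʳ-footprint g′
    in t ++ r , x , z , g′ , und , Closed-InN closed Cx xz

  toSubset : List (Fin n) → Subset n
  toSubset L = tabulate (λ v → does (v ∈? L))

  ∈-toSubset : ∀ L v → v ∈ₛ toSubset L ⇔ v ∈ L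
  ∈-toSubset L v with v ∈? L | lookup∘tabulate (λ w → does (w ∈? L)) v
  ... | yes v∈L | eq = mk⇔ (const v∈L) (const (lookup⇒[]= v _ eq))
  ... | no v∉L  | eq = mk⇔ (λ v∈ → contradiction (trans (sym eq) ([]=⇒lookup v∈)) λ ()) (⊥-elim ∘ v∉L)

  IsGrundySeq⇒IsGrundyDominatingSet : ∀ {s} → IsGrundySeq G s → IsGrundyDominatingSet G (toSubset s)
  IsGrundySeq⇒IsGrundyDominatingSet {s} g = s , g , ∈-toSubset s

  NonIsolatedIn : List (Fin n) → Pred (Fin n) 0ℓ
  NonIsolatedIn L x = x ∈ L × ∃[ y ] y ∈ L × Adj G x y

  NonIsolatedIn? : ∀ L → Decidable (NonIsolatedIn L)
  NonIsolatedIn? L x = (x ∈? L) ×-dec Fin.any? (λ y → (y ∈? L) ×-dec (adj x y Bool.≟ true))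

  nonIsolatedCount : List (Fin n) → ℕ
  nonIsolatedCount L = count (NonIsolatedIn? L)

  nonIsolatedCount-automorphism : ∀ S T (φ : Permutation′ n) → IsAutomorphism G φ →
                                  (∀ v → v ∈ S ⇔ (φ ⟨$⟩ʳ v) ∈ T) → nonIsolatedCount S ≡ nonIsolatedCount T
  nonIsolatedCount-automorphism S T φ aut S⇔T =
    count-permute (NonIsolatedIn? S) (NonIsolatedIn? T) φ λ v → mk⇔
      (λ (v∈ , y , y∈ , vy) → to (S⇔T v) v∈ , φ ⟨$⟩ʳ y , to (S⇔T y) y∈ , trans (aut v y) vy)
      (λ (φv∈ , y , y∈ , φvy) → from (S⇔T v) φv∈ , φ ⟨$⟩ˡ y ,
         from (S⇔T _) (subst (_∈ T) (sym (inverseʳ φ)) y∈) ,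
         trans (sym (aut v _)) (subst (λ w → adj (φ ⟨$⟩ʳ v) w ≡ true) (sym (inverseʳ φ)) φvy))

  nonIsolatedCount-< : ∀ {P a b} → Undominated P a → Adj G a b → Any (λ p → InN G p b) P →
                       nonIsolatedCount (P ∷ʳ a) < nonIsolatedCount (P ∷ʳ b)
  nonIsolatedCount-< {P} {a} {b} und-a ab P-dom-b =
    ⊂⇒count< (NonIsolatedIn? (P ∷ʳ a)) (NonIsolatedIn? (P ∷ʳ b)) keep b lost gained
    where
    ¬P-InN-a : ∀ {p} → p ∈ P → ¬ InN G p a
    ¬P-InN-a = All.lookup und-a
    keep : NonIsolatedIn (P ∷ʳ a) ⊆ NonIsolatedIn (P ∷ʳ b)
    keep (x∈ , y , y∈ , xy) with ∈-∷ʳ⁻ P x∈ | ∈-∷ʳ⁻ P y∈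
    ... | inj₁ x∈P | inj₁ y∈P = ∈-++⁺ˡ x∈P , y , ∈-++⁺ˡ y∈P , xy
    ... | inj₁ x∈P | inj₂ refl = contradiction (inj₂ xy) (¬P-InN-a x∈P)
    ... | inj₂ refl | inj₁ y∈P = contradiction (inj₂ (Adj-sym xy)) (¬P-InN-a y∈P)
    ... | inj₂ refl | inj₂ refl = contradiction xy Adj-irrefl
    lost : ¬ NonIsolatedIn (P ∷ʳ a) b
    lost (b∈ , _) with ∈-∷ʳ⁻ P b∈
    ... | inj₁ b∈P = ¬P-InN-a b∈P (inj₂ (Adj-sym ab))
    ... | inj₂ refl = Adj-irrefl ab
    gained : NonIsolatedIn (P ∷ʳ b) b
    gained with find P-dom-b
    ... | p , p∈P , inj₁ refl = contradiction (inj₂ (Adj-sym ab)) (¬P-InN-a p∈P)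
    ... | p , p∈P , inj₂ pb   = ∈-++⁺ʳ P (here refl) , p , ∈-++⁺ˡ p∈P , Adj-sym pb

  record Transversal (S : List (Fin n)) : Set where
    field
      dominating  : ∀ y → ∃[ s ] s ∈ S × InN G s y
      independent : ∀ {s s′} → s ∈ S → s′ ∈ S → InN G s s′ → s ≡ s′
  open Transversal

  InN⇒Adj : ∀ {x y} → InN G x y → ¬ x ≡ y → Adj G x y
  InN⇒Adj (inj₁ refl) x≢x = contradiction refl x≢x
  InN⇒Adj (inj₂ xy)   _   = xy

  module _ (complete : ComponentsComplete G) where

    InN-trans : ∀ {x y z} → InN G x y → InN G y z → InN G x z
    InN-trans {x} {z = z} xy yz with z ≟ x
    ... | yes z≡x = inj₁ z≡x
    ... | no z≢x  = inj₂ (complete x z (InN⇒SameComponent xy ◅◅ InN⇒SameComponent yz) (z≢x ∘ sym))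

    CNSFrom-avoids : ∀ {prev y x} s → CNSFrom G prev s → y ∈ prev → x ∈ s → ¬ InN G y x
    CNSFrom-avoids (v ∷ vs) ((z , vz , und) , _) y∈prev (here refl) yx = All.lookup und y∈prev (InN-trans yx vz)
    CNSFrom-avoids (v ∷ vs) (_ , rest) y∈prev (there x∈vs) = CNSFrom-avoids vs rest (there y∈prev) x∈vs

    CNSFrom-InN⇒≡ : ∀ {prev x y} s → CNSFrom G prev s → x ∈ s → y ∈ s → InN G x y → x ≡ y
    CNSFrom-InN⇒≡ (v ∷ vs) _           (here refl) (here refl) _  = refl
    CNSFrom-InN⇒≡ (v ∷ vs) (_ , rest) (here refl) (there y∈) xy = contradiction xy (CNSFrom-avoids vs rest (here refl) y∈)
    CNSFrom-InN⇒≡ (v ∷ vs) (_ , rest) (there x∈) (here refl) xy =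
      contradiction (InN-sym xy) (CNSFrom-avoids vs rest (here refl) x∈)
    CNSFrom-InN⇒≡ (v ∷ vs) (_ , rest) (there x∈) (there y∈) xy = CNSFrom-InN⇒≡ vs rest x∈ y∈ xy

    IsGrundySeq⇒Transversal : ∀ {s} → IsGrundySeq G s → Transversal s
    IsGrundySeq⇒Transversal {s} g@((_ , c) , _) = record
      { dominating  = λ y → find (IsGrundySeq-dominates g y)
      ; independent = CNSFrom-InN⇒≡ s c
      }

    -- v ↦ w under the involution exchanging, in each closed neighbourhood, the vertex of A
    -- with the vertex of B and fixing every other vertex.
    Swap : List (Fin n) → List (Fin n) → Fin n → Fin n → Set
    Swap A B v w = InN G v w × (v ∈ A ⇔ w ∈ B) × (v ∈ B ⇔ w ∈ A) × (v ∈ A ⊎ v ∈ B ⊎ v ≡ w)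

    Swap-flip : ∀ {A B v w} → Swap B A v w → Swap A B v w
    Swap-flip (vw , ba , ab , c) = vw , ab , ba , [ inj₂ ∘ inj₁ , [ inj₁ , inj₂ ∘ inj₂ ] ] c

    Swap-sym : ∀ {A B v w} → Swap A B v w → Swap A B w v
    Swap-sym (vw , ab , ba , c) =
      InN-sym vw , ⇔.sym ba , ⇔.sym ab , [ inj₂ ∘ inj₁ ∘ to ab , [ inj₁ ∘ to ba , inj₂ ∘ inj₂ ∘ sym ] ] c

    Swap-functional : ∀ {A B v w w′} → Transversal A → Transversal B →
                      Swap A B v w → Swap A B v w′ → w ≡ w′
    Swap-functional {A} {B} {v} {w} {w′} tA tB (vw , ab , ba , c) (vw′ , ab′ , ba′ , c′) = cases c c′
      where
      ww′ : InN G w w′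
      ww′ = InN-trans (InN-sym vw) vw′
      cases : v ∈ A ⊎ v ∈ B ⊎ v ≡ w → v ∈ A ⊎ v ∈ B ⊎ v ≡ w′ → w ≡ w′
      cases (inj₁ v∈A)        _                 = independent tB (to ab v∈A) (to ab′ v∈A) ww′
      cases (inj₂ (inj₁ v∈B)) _                 = independent tA (to ba v∈B) (to ba′ v∈B) ww′
      cases _                 (inj₁ v∈A)        = independent tB (to ab v∈A) (to ab′ v∈A) ww′
      cases _                 (inj₂ (inj₁ v∈B)) = independent tA (to ba v∈B) (to ba′ v∈B) ww′
      cases (inj₂ (inj₂ v≡w)) (inj₂ (inj₂ v≡w′)) = trans (sym v≡w) v≡w′

    Swap-representative : ∀ {A B v s} → Transversal A → Transversal B → v ∈ A → s ∈ B → InN G s v →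
                          Swap A B v s
    Swap-representative {A} {B} {v} {s} tA tB v∈A s∈B sv =
      vs , mk⇔ (const s∈B) (const v∈A) ,
      mk⇔ (λ v∈B → subst (_∈ A) (independent tB v∈B s∈B vs) v∈A)
          (λ s∈A → subst (_∈ B) (sym (independent tA v∈A s∈A vs)) s∈B) ,
      inj₁ v∈A
      where
      vs : InN G v s
      vs = InN-sym sv

    Swap-exists : ∀ {A B} → Transversal A → Transversal B → ∀ v → ∃ (Swap A B v)
    Swap-exists {A} {B} tA tB v with v ∈? A | v ∈? B
    ... | yes v∈A | _ = let s , s∈B , sv = dominating tB v in s , Swap-representative tA tB v∈A s∈B sv
    ... | no _ | yes v∈B = let s , s∈A , sv = dominating tA v in s , Swap-flip (Swap-representative tB tA v∈B s∈A sv)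
    ... | no v∉A | no v∉B = v , inj₁ refl , mk⇔ (⊥-elim ∘ v∉A) (⊥-elim ∘ v∉B) ,
                            mk⇔ (⊥-elim ∘ v∉B) (⊥-elim ∘ v∉A) , inj₂ (inj₂ refl)

    swapPermutation : ∀ {A B} → Transversal A → Transversal B → Permutation′ n
    swapPermutation tA tB = permutation swap swap involutive involutive
      where
      swap : Fin n → Fin n
      swap = proj₁ ∘ Swap-exists tA tB
      involutive : ∀ v → swap (swap v) ≡ v
      involutive v = Swap-functional tA tB (proj₂ (Swap-exists tA tB _)) (Swap-sym (proj₂ (Swap-exists tA tB v)))

    InN-preserving⇒automorphism : (φ : Permutation′ n) → (∀ v → InN G v (φ ⟨$⟩ʳ v)) → IsAutomorphism G φ
    InN-preserving⇒automorphism φ near u v = ≡true-⇔⇒≡ (mk⇔ reflect preserve)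
      where
      reflect : Adj G (φ ⟨$⟩ʳ u) (φ ⟨$⟩ʳ v) → Adj G u v
      reflect φuv = InN⇒Adj (InN-trans (near u) (InN-trans (inj₂ φuv) (InN-sym (near v))))
                            λ { refl → Adj-irrefl φuv }
      φ-injective : φ ⟨$⟩ʳ u ≡ φ ⟨$⟩ʳ v → u ≡ v
      φ-injective φu≡φv = trans (sym (inverseˡ φ)) (trans (cong (φ ⟨$⟩ˡ_) φu≡φv) (inverseˡ φ))
      preserve : Adj G u v → Adj G (φ ⟨$⟩ʳ u) (φ ⟨$⟩ʳ v)
      preserve uv = InN⇒Adj (InN-trans (InN-sym (near u)) (InN-trans (inj₂ uv) (near v)))
                            λ φu≡φv → Adj-irrefl (subst (Adj G u) (sym (φ-injective φu≡φv)) uv)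

    components-complete⇒iso-unique : IsoUniqueGrundyDomination G
    components-complete⇒iso-unique A B (s , gs , A⇔s) (t , gt , B⇔t) =
      φ , InN-preserving⇒automorphism φ (λ v → proj₁ (swap v)) ,
      λ v → ⇔.trans (A⇔s v) (⇔.trans (proj₁ (proj₂ (swap v))) (⇔.sym (B⇔t _)))
      where
      ts : Transversal s
      ts = IsGrundySeq⇒Transversal gs
      tt : Transversal t
      tt = IsGrundySeq⇒Transversal gt
      φ : Permutation′ n
      φ = swapPermutation ts tt
      swap : ∀ v → Swap s t v (φ ⟨$⟩ʳ v)
      swap v = proj₂ (Swap-exists ts tt v)

  module _ (iso : IsoUniqueGrundyDomination G) where

    nonIsolatedCount-invariant : ∀ {s t} → IsGrundySeq G s → IsGrundySeq G t →
                                 nonIsolatedCount s ≡ nonIsolatedCount t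
    nonIsolatedCount-invariant {s} {t} gs gt =
      let φ , aut , s⇔t = iso _ _ (IsGrundySeq⇒IsGrundyDominatingSet gs) (IsGrundySeq⇒IsGrundyDominatingSet gt)
      in nonIsolatedCount-automorphism s t φ aut λ v →
           ⇔.trans (⇔.sym (∈-toSubset s v)) (⇔.trans (s⇔t v) (∈-toSubset t _))

    undominated-closed : ∀ {P x} → IsGrundySeq G (P ∷ʳ x) → Closed (Undominated P)
    undominated-closed {P} g {a} {b} und-a ab with All.all? (λ w → ¬? (InN? w b)) P
    ... | yes und-b = und-b
    ... | no ¬und-b = contradiction
          (nonIsolatedCount-invariant (IsGrundySeq-∷ʳ-replace g und-a (inj₁ refl))
                                      (IsGrundySeq-∷ʳ-replace g und-a (inj₂ (Adj-sym ab))))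
          (<⇒≢ (nonIsolatedCount-< und-a ab P-dom-b))
      where
      P-dom-b : Any (λ p → InN G p b) P
      P-dom-b = Any.map (decidable-stable (InN? _ b)) (¬All⇒Any¬ (λ w → ¬? (InN? w b)) P ¬und-b)

    undominated-along : ∀ {P x a b} → IsGrundySeq G (P ∷ʳ x) → SameComponent G a b →
                        Undominated P a → Undominated P b
    undominated-along g ε          und = und
    undominated-along g (ab ◅ path) und = undominated-along g path (undominated-closed g und ab)

    iso-unique⇒components-complete : ComponentsComplete G
    iso-unique⇒components-complete u v u~v u≢v = decidable-stable (adj u v Bool.≟ true) λ ¬uv →
      ¬¬-IsGrundySeq λ (s , g) → ¬¬-decidable (SameComponent G u) λ C? →
        let P , x , z , g′ , und-z , u~z = undominated-in-closed g C? SameComponent-closed ε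
            z~u = Star.reverse Adj-sym u~z
        in [ u≢v ∘ sym , ¬uv ]
             (undominated-InN g′ (undominated-along g′ z~u und-z) (undominated-along g′ (z~u ◅◅ u~v) und-z))

theorem4p4 : (n : ℕ) (G : Graph n) → IsoUniqueGrundyDomination G ⇔ ComponentsComplete G
theorem4p4 n G = mk⇔ (iso-unique⇒components-complete G) (components-complete⇒iso-unique G)
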